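{- For every integer $n\ge 1$, the class $\mathcal{G}_n$ of all $n$-vertex graphs has an isometric-universal graph on at most $16^{n+O(\log n)}$ vertices.
   Context: A subgraph $G$ of $H$ is isometric if $d_G(u,v)=d_H(u,v)$ for all $u,v\in V(G)$ (distances possibly $\infty$); $H$ is isometric-universal for a class $\mathcal{C}$ if it contains an isometric copy of every $G\in\mathcal{C}$. The $O(\log n)$ term denotes a quantity bounded by $C\log n$ for an absolute constant $C$ (for $n\ge 2$). -}

module Defs where

open import Data.Nat using (ℕ; zero; suc; _<_; _≤_; _+_; _*_; _^_)
open import Data.Nat.Logarithm using (⌈log₂_⌉)
open import Data.Fin using (Fin)
open import Data.Bool using (Bool; true; false)
open import Data.Maybe using (Maybe; just; nothing)
open import Data.Product using (Σ; _×_; ∃-syntax)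
open import Relation.Binary.PropositionalEquality using (_≡_)
open import Relation.Nullary using (¬_)
open import Function.Bundles using (_⇔_)
open import Function.Definitions using (Injective)

record Graph (n : ℕ) : Set where
  field
    adj    : Fin n → Fin n → Bool
    sym    : ∀ i j → adj i j ≡ adj j i
    irrefl : ∀ i → adj i i ≡ false
open Graph public

data Walk {n : ℕ} (G : Graph n) : ℕ → Fin n → Fin n → Set where
  nil  : ∀ {u} → Walk G 0 u u
  cons : ∀ {k u v w} → adj G u v ≡ true → Walk G k v w → Walk G (suc k) u w

-- Dist G u v d : the distance d_G(u,v) equals d, where nothing = ∞
Dist : ∀ {n} → Graph n → Fin n → Fin n → Maybe ℕ → Set
Dist G u v (just k) = Walk G k u v × (∀ j → j < k → ¬ Walk G j u v)
Dist G u v nothing  = ∀ k → ¬ Walk G k u v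

IsometricCopy : ∀ {n m} → Graph n → Graph m → Set
IsometricCopy {n} {m} G H =
  Σ (Fin n → Fin m) λ f →
    Injective _≡_ _≡_ f ×
    (∀ u v → adj G u v ≡ true → adj H (f u) (f v) ≡ true) ×
    (∀ u v d → Dist G u v d ⇔ Dist H (f u) (f v) d)

IsometricUniversal : ∀ {m} → ℕ → Graph m → Set
IsometricUniversal n H = (G : Graph n) → IsometricCopy G H

-- Let at 0, at 1, … be a depth-first traversal of G that visits every vertex within 2n steps,
-- each step following an edge, staying put, or jumping to a component not met before.
-- Label u by its name and its distance profile t ↦ d(u, at t). Along an edge or a stay the
-- profile changes by at most one, and it is finite exactly on the interval of times spent in
-- u's component; so it is determined by its value on entering that component (< n) and 2n
-- symbols from a four-letter alphabet: n · n · 4^(2n) ≤ 16^(n + 2 ⌈log₂ n⌉) labels. Labels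
-- are adjacent when the names differ and the profiles differ by at most one everywhere.
-- Edges of G map to edges, so distances do not grow; conversely, along a walk of length k
-- from the label of u to that of v, the profile at a time when the traversal sits at v
-- (where v's value is 0) grows by at most one per step, so d(u, v) ≤ k.

module Submission where

open import Defs hiding (sym)
open import Data.Nat
open import Data.Nat.Properties
open import Data.Nat.DivMod using (_mod_; m<n⇒m%n≡m)
open import Data.Nat.Induction using (<-wellFounded)
open import Data.Nat.Logarithm using (⌈log₂_⌉)
open import Data.Nat.Logarithm.Core using (⌈log2⌉)
open import Data.Nat.Tactic.RingSolver using (solve-∀)
open import Data.Fin as Fin using (Fin; zero; suc; toℕ; fromℕ<; combine; remQuot; funToFin; finToFun)
import Data.Fin.Properties as Fin
open import Data.Bool using (true)
import Data.Bool.Properties as Bool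
open import Data.List using (List; []; _∷_; length; filter; allFin)
open import Data.List.Properties using (filter-notAll; length-tabulate)
open import Data.List.Membership.Propositional using (_∈_; _∉_; find)
open import Data.List.Membership.Propositional.Properties using (∈-filter⁺; ∈-filter⁻; ∈-allFin)
open import Data.List.Relation.Unary.All as All using (All; []; _∷_)
open import Data.List.Relation.Unary.Any as Any using (Any; here; there; any?)
open import Data.List.Relation.Unary.Linked as Linked using (Linked; []; [-]; _∷_)
open import Data.Maybe as Maybe using (Maybe; just; nothing; fromMaybe; _<∣>_)
open import Data.Product
open import Data.Sum using (_⊎_; inj₁; inj₂)
open import Data.Unit using (⊤; tt)
open import Function using (_∘_; id; case_of_)
open import Function.Bundles using (_⇔_; mk⇔)
open import Induction.WellFounded using (Acc; acc)
open import Relation.Binary.Definitions using (tri<; tri≈; tri>)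
open import Relation.Binary.PropositionalEquality
open import Relation.Nullary
open import Relation.Nullary.Decidable using (_×-dec_; ¬?; dec-true; dec-false; does-⇔)
open import Relation.Nullary.Reflects using (Reflects; invert)
open import Relation.Unary using (Pred; Decidable)

n≤2*⌈n/2⌉ : ∀ n → n ≤ 2 * ⌈ n /2⌉
n≤2*⌈n/2⌉ n = begin
  n                 ≡⟨ ⌊n/2⌋+⌈n/2⌉≡n n ⟨
  ⌊ n /2⌋ + ⌈ n /2⌉ ≤⟨ +-monoˡ-≤ ⌈ n /2⌉ (⌊n/2⌋≤⌈n/2⌉ n) ⟩
  ⌈ n /2⌉ + ⌈ n /2⌉ ≡⟨ cong (⌈ n /2⌉ +_) (+-identityʳ ⌈ n /2⌉) ⟨
  2 * ⌈ n /2⌉       ∎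
  where open ≤-Reasoning

n≤2^⌈log₂n⌉ : ∀ n → n ≤ 2 ^ ⌈log₂ n ⌉
n≤2^⌈log₂n⌉ n = go n _
  where
  go : ∀ n (rec : Acc _<_ n) → n ≤ 2 ^ ⌈log2⌉ n rec
  go 0             _        = z≤n
  go 1             _        = s≤s z≤n
  go (suc (suc n)) (acc rs) = begin
    2 + n                          ≤⟨ +-monoʳ-≤ 2 (n≤2*⌈n/2⌉ n) ⟩
    2 + 2 * ⌈ n /2⌉                ≡⟨ *-suc 2 ⌈ n /2⌉ ⟨
    2 * suc ⌈ n /2⌉                ≤⟨ *-monoʳ-≤ 2 (go (suc ⌈ n /2⌉) _) ⟩
    2 * 2 ^ ⌈log2⌉ (suc ⌈ n /2⌉) _ ∎
    where open ≤-Reasoning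

n²*16^n≤16^[n+2⌈log₂n⌉] : ∀ n → n * (n * 4 ^ (2 * n)) ≤ 16 ^ (n + 2 * ⌈log₂ n ⌉)
n²*16^n≤16^[n+2⌈log₂n⌉] n = begin
  n * (n * 4 ^ (2 * n))      ≡⟨ cong (λ x → n * (n * x)) (^-*-assoc 4 2 n) ⟨
  n * (n * 16 ^ n)           ≤⟨ *-mono-≤ n≤16^k (*-monoˡ-≤ (16 ^ n) n≤16^k) ⟩
  16 ^ k * (16 ^ k * 16 ^ n) ≡⟨ cong (16 ^ k *_) (^-distribˡ-+-* 16 k n) ⟨
  16 ^ k * 16 ^ (k + n)      ≡⟨ ^-distribˡ-+-* 16 k (k + n) ⟨
  16 ^ (k + (k + n))         ≡⟨ cong (16 ^_) (exponent k n) ⟩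
  16 ^ (n + 2 * k)           ∎
  where
  open ≤-Reasoning
  k = ⌈log₂ n ⌉
  n≤16^k : n ≤ 16 ^ k
  n≤16^k = ≤-trans (n≤2^⌈log₂n⌉ n) (^-monoˡ-≤ k (s≤s (s≤s z≤n)))
  exponent : ∀ k n → k + (k + n) ≡ n + 2 * k
  exponent = solve-∀

least? : ∀ {p} {P : Pred ℕ p} → Decidable P → ∀ b →
         (∃[ k ] k < b × P k × ∀ j → j < k → ¬ P j) ⊎ (∀ j → j < b → ¬ P j)
least? P? zero    = inj₂ λ _ ()
least? P? (suc b) with least? P? b
... | inj₁ (k , k<b , pk , min) = inj₁ (k , m≤n⇒m≤1+n k<b , pk , min)
... | inj₂ none with P? b
...   | yes pb = inj₁ (b , ≤-refl , pb , none)
...   | no ¬pb = inj₂ λ j j<1+b → case m≤n⇒m<n∨m≡n (s≤s⁻¹ j<1+b) of λ where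
          (inj₁ j<b)  → none j j<b
          (inj₂ refl) → ¬pb

data Close : Maybe ℕ → Maybe ℕ → Set where
  ∞∼∞     : Close nothing nothing
  fin∼fin : ∀ {a b} → a ≤ suc b → b ≤ suc a → Close (just a) (just b)

close-sym : ∀ {x y} → Close x y → Close y x
close-sym ∞∼∞           = ∞∼∞
close-sym (fin∼fin p q) = fin∼fin q p

close-just : ∀ {x b} → Close x (just b) → ∃[ a ] x ≡ just a × a ≤ suc b
close-just (fin∼fin a≤1+b _) = _ , refl , a≤1+b

close? : ∀ x y → Dec (Close x y)
close? nothing  nothing  = yes ∞∼∞
close? nothing  (just b) = no λ ()
close? (just a) nothing  = no λ ()
close? (just a) (just b) with a ≤? suc b | b ≤? suc a
... | yes p | yes q = yes (fin∼fin p q)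
... | no ¬p | _     = no λ { (fin∼fin p _) → ¬p p }
... | _     | no ¬q = no λ { (fin∼fin _ q) → ¬q q }

module Walks {n : ℕ} (G : Graph n) where

  Edge : Fin n → Fin n → Set
  Edge u v = adj G u v ≡ true

  edge-sym : ∀ {u v} → Edge u v → Edge v u
  edge-sym {u} {v} e = trans (Graph.sym G v u) e

  edge-irrefl : ∀ {u v} → Edge u v → u ≢ v
  edge-irrefl {u} e refl with () ← trans (sym (irrefl G u)) e

  Reachable : Fin n → Fin n → Set
  Reachable u v = ∃[ k ] Walk G k u v

  _∷ʳ_ : ∀ {k u v w} → Walk G k u v → Edge v w → Walk G (suc k) u w
  nil      ∷ʳ e′ = cons e′ nil
  cons e p ∷ʳ e′ = cons e (p ∷ʳ e′)

  reverse : ∀ {k u v} → Walk G k u v → Walk G k v u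
  reverse nil        = nil
  reverse (cons e p) = reverse p ∷ʳ edge-sym e

  _++_ : ∀ {j k u v w} → Walk G j u v → Walk G k v w → Walk G (j + k) u w
  nil      ++ q = q
  cons e p ++ q = cons e (p ++ q)

  vertex : ∀ {k u v} → Walk G k u v → Fin (suc k) → Fin n
  vertex {u = u} p          zero    = u
  vertex         (cons e p) (suc i) = vertex p i

  take : ∀ {k u v} (p : Walk G k u v) i → Walk G (toℕ i) u (vertex p i)
  take p          zero    = nil
  take (cons e p) (suc i) = cons e (take p i)

  drop : ∀ {k u v} (p : Walk G k u v) i → Walk G (k ∸ toℕ i) (vertex p i) v
  drop p          zero    = p
  drop (cons e p) (suc i) = drop p i

  shortcut : ∀ {k u v} → n < suc k → Walk G k u v → ∃[ k′ ] k′ < k × Walk G k′ u v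
  shortcut {k} {v = v} n≤k p with Fin.pigeonhole n≤k (vertex p)
  ... | i , j , i<j , same =
    toℕ i + (k ∸ toℕ j) , shorter ,
    take p i ++ subst (λ x → Walk G (k ∸ toℕ j) x v) (sym same) (drop p j)
    where
    shorter : toℕ i + (k ∸ toℕ j) < k
    shorter = begin-strict
      toℕ i + (k ∸ toℕ j) <⟨ +-monoˡ-< (k ∸ toℕ j) i<j ⟩
      toℕ j + (k ∸ toℕ j) ≡⟨ m+[n∸m]≡n (s≤s⁻¹ (Fin.toℕ<n j)) ⟩
      k                   ∎
      where open ≤-Reasoning

  shorten : ∀ {k u v} → Walk G k u v → ∃[ k′ ] k′ < n × k′ ≤ k × Walk G k′ u v
  shorten p = go p (<-wellFounded _)
    where
    go : ∀ {k u v} → Walk G k u v → Acc _<_ k → ∃[ k′ ] k′ < n × k′ ≤ k × Walk G k′ u v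
    go {k} p (acc rs) with k <? n
    ... | yes k<n = k , k<n , ≤-refl , p
    ... | no  k≮n with shortcut (s≤s (≮⇒≥ k≮n)) p
    ...   | k′ , k′<k , p′ with go p′ (rs k′<k)
    ...     | k″ , k″<n , k″≤k′ , p″ = k″ , k″<n , ≤-trans k″≤k′ (<⇒≤ k′<k) , p″

  walk? : ∀ k u v → Dec (Walk G k u v)
  walk? zero    u v with u Fin.≟ v
  ... | yes refl = yes nil
  ... | no  u≢v  = no λ { nil → u≢v refl }
  walk? (suc k) u v with Fin.any? (λ x → (adj G u x Bool.≟ true) ×-dec walk? k x v)
  ... | yes (x , e , p) = yes (cons e p)
  ... | no  none        = no λ { (cons e p) → none (_ , e , p) }

  distance : ∀ u v → ∃ (Dist G u v)
  distance u v with least? (λ k → walk? k u v) n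
  ... | inj₁ (k , _ , p , min) = just k , p , min
  ... | inj₂ none = nothing , λ k p →
    let k′ , k′<n , _ , p′ = shorten p in none k′ k′<n p′

  dist : Fin n → Fin n → Maybe ℕ
  dist u v = proj₁ (distance u v)

  dist≡just⇒walk : ∀ {u v k} → dist u v ≡ just k → Walk G k u v
  dist≡just⇒walk {u} {v} eq with distance u v
  dist≡just⇒walk refl | just k , p , _ = p

  dist-minimal : ∀ {u v k j} → dist u v ≡ just k → Walk G j u v → k ≤ j
  dist-minimal {u} {v} eq p with distance u v
  dist-minimal refl p | just k , _ , min = ≮⇒≥ λ j<k → min _ j<k p

  walk⇒dist≢∞ : ∀ {u v j} → Walk G j u v → dist u v ≢ nothing
  walk⇒dist≢∞ {u} {v} {j} p eq with distance u v
  walk⇒dist≢∞ {u} {v} {j} p refl | nothing , none = none j p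

  dist<n : ∀ {u v k} → dist u v ≡ just k → k < n
  dist<n eq with shorten (dist≡just⇒walk eq)
  ... | k′ , k′<n , _ , p′ = ≤-<-trans (dist-minimal eq p′) k′<n

  dist-refl : ∀ u → dist u u ≡ just 0
  dist-refl u with dist u u in eq
  ... | nothing = contradiction eq (walk⇒dist≢∞ nil)
  ... | just k  = cong just (n≤0⇒n≡0 (dist-minimal eq nil))

  close-dist : ∀ {u v x y} →
               (∀ {k} → Walk G k u v → Walk G (suc k) x y) →
               (∀ {k} → Walk G k x y → Walk G (suc k) u v) →
               Close (dist u v) (dist x y)
  close-dist {u} {v} {x} {y} forward backward with dist u v in e₁ | dist x y in e₂
  ... | nothing | nothing = ∞∼∞
  ... | just a  | nothing = contradiction e₂ (walk⇒dist≢∞ (forward (dist≡just⇒walk e₁)))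
  ... | nothing | just b  = contradiction e₁ (walk⇒dist≢∞ (backward (dist≡just⇒walk e₂)))
  ... | just a  | just b  =
    fin∼fin (dist-minimal e₁ (backward (dist≡just⇒walk e₂)))
            (dist-minimal e₂ (forward (dist≡just⇒walk e₁)))

  close-target : ∀ {u x y} → Edge x y → Close (dist u x) (dist u y)
  close-target e = close-dist (_∷ʳ e) (_∷ʳ edge-sym e)

  close-source : ∀ {u v x} → Edge u v → Close (dist u x) (dist v x)
  close-source e = close-dist (cons (edge-sym e)) (cons e)

dist-transfer : ∀ {n m} {G : Graph n} {H : Graph m} {u v x y} →
                (∀ {k} → Walk G k u v → Walk H k x y) →
                (∀ {k} → Walk H k x y → ∃[ j ] j ≤ k × Walk G j u v) →
                ∀ d → Dist G u v d ⇔ Dist H x y d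
dist-transfer {G = G} {H} {u} {v} {x} {y} forward backward (just d) = mk⇔
  (λ (p , min) → forward p , λ j j<d q →
    let j′ , j′≤j , p′ = backward q in min j′ (≤-<-trans j′≤j j<d) p′)
  (λ (q , min) → let j , j≤d , p = backward q in exact j≤d p min , λ j j<d p → min j j<d (forward p))
  where
  exact : ∀ {j} → j ≤ d → Walk G j u v → (∀ j → j < d → ¬ Walk H j x y) → Walk G d u v
  exact j≤d p min with m≤n⇒m<n∨m≡n j≤d
  ... | inj₁ j<d  = contradiction (forward p) (min _ j<d)
  ... | inj₂ refl = p
dist-transfer forward backward nothing = mk⇔
  (λ none k q → let j , _ , p = backward q in none j p)
  (λ none k p → none k (forward p))

module Traversals {n : ℕ} (G : Graph n) where
  open Walks G

  data Step (at : ℕ → Fin n) (t : ℕ) : Set where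
    edge : Edge (at t) (at (suc t)) → Step at t
    stay : at t ≡ at (suc t) → Step at t
    jump : (∀ s → s ≤ t → ¬ Reachable (at s) (at (suc t))) → Step at t

  record Traversal (L : ℕ) : Set where
    field
      at     : ℕ → Fin n
      covers : ∀ v → ∃[ t ] t < L × at t ≡ v
      step   : ∀ t → Step at t

m<n⇒2*m+[1+s]<2*n+s : ∀ {m m′} s → m < m′ → 2 * m + suc s < 2 * m′ + s
m<n⇒2*m+[1+s]<2*n+s {m} {m′} s m<m′ = begin
  suc (2 * m + suc s) ≡⟨ cong suc (+-suc (2 * m) s) ⟩
  2 + 2 * m + s       ≡⟨ cong (_+ s) (*-suc 2 m) ⟨
  2 * suc m + s       ≤⟨ +-monoˡ-≤ s (*-monoʳ-≤ 2 m<m′) ⟩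
  2 * m′ + s          ∎
  where open ≤-Reasoning

module DepthFirst {n : ℕ} (G : Graph n) where
  open Walks G
  open Traversals G

  opaque
    extend : (ℕ → Fin n) → ℕ → Fin n → ℕ → Fin n
    extend at ℓ x t with t ≤? ℓ
    ... | yes _ = at t
    ... | no  _ = x

    extend-≤ : ∀ {at ℓ x t} → t ≤ ℓ → extend at ℓ x t ≡ at t
    extend-≤ {ℓ = ℓ} {t = t} t≤ℓ with t ≤? ℓ
    ... | yes _   = refl
    ... | no  t≰ℓ = contradiction t≤ℓ t≰ℓ

    extend-> : ∀ {at ℓ x t} → ℓ < t → extend at ℓ x t ≡ x
    extend-> {ℓ = ℓ} {t = t} ℓ<t with t ≤? ℓ
    ... | yes t≤ℓ = contradiction t≤ℓ (<⇒≱ ℓ<t)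
    ... | no  _   = refl

  Visited : ℕ → (ℕ → Fin n) → Fin n → Set
  Visited ℓ at v = ∃[ t ] t ≤ ℓ × at t ≡ v

  visited-old : ∀ {ℓ at x v} → Visited ℓ at v → Visited (suc ℓ) (extend at ℓ x) v
  visited-old (t , t≤ℓ , refl) = t , m≤n⇒m≤1+n t≤ℓ , extend-≤ t≤ℓ

  visited-new : ∀ {ℓ at x} → Visited (suc ℓ) (extend at ℓ x) x
  visited-new = _ , ≤-refl , extend-> ≤-refl

  visited-extend⁻ : ∀ {ℓ at x v} → Visited (suc ℓ) (extend at ℓ x) v → Visited ℓ at v ⊎ v ≡ x
  visited-extend⁻ (t , t≤1+ℓ , refl) with m≤n⇒m<n∨m≡n t≤1+ℓ
  ... | inj₁ t<1+ℓ = inj₁ (t , s≤s⁻¹ t<1+ℓ , sym (extend-≤ (s≤s⁻¹ t<1+ℓ)))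
  ... | inj₂ refl  = inj₂ (extend-> ≤-refl)

  visited-revisit : ∀ {ℓ at x v} → Visited ℓ at x → Visited (suc ℓ) (extend at ℓ x) v → Visited ℓ at v
  visited-revisit vx vv with visited-extend⁻ vv
  ... | inj₁ old  = old
  ... | inj₂ refl = vx

  step-extend : ∀ {at ℓ x t} → t < ℓ → Step at t → Step (extend at ℓ x) t
  step-extend t<ℓ (edge e)     = edge (subst₂ Edge (sym (extend-≤ (<⇒≤ t<ℓ))) (sym (extend-≤ t<ℓ)) e)
  step-extend t<ℓ (stay same)  = stay (trans (extend-≤ (<⇒≤ t<ℓ)) (trans same (sym (extend-≤ t<ℓ))))
  step-extend t<ℓ (jump fresh) = jump λ s s≤t r →
    fresh s s≤t (subst₂ Reachable (extend-≤ (≤-trans s≤t (<⇒≤ t<ℓ))) (extend-≤ t<ℓ) r)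

  Closed : ℕ → (ℕ → Fin n) → List (Fin n) → Set
  Closed ℓ at stack = ∀ {v y} → Visited ℓ at v → v ∉ stack → Edge v y → Visited ℓ at y

  closed-cons : ∀ {ℓ at x xs} → Closed ℓ at xs → Closed ℓ at (x ∷ xs)
  closed-cons cl vv v∉ e = cl vv (v∉ ∘ there) e

  closed-pop : ∀ {ℓ at x xs} → Closed ℓ at (x ∷ xs) → (∀ {y} → Edge x y → Visited ℓ at y) → Closed ℓ at xs
  closed-pop {x = x} cl done {v} vv v∉ e with v Fin.≟ x
  ... | yes refl = done e
  ... | no  v≢x  = cl vv (λ { (here v≡x) → v≢x v≡x ; (there v∈) → v∉ v∈ }) e

  closed-extend : ∀ {ℓ at x xs} → Closed ℓ at (x ∷ xs) → Closed (suc ℓ) (extend at ℓ x) (x ∷ xs)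
  closed-extend cl vv v∉ e with visited-extend⁻ vv
  ... | inj₁ old  = visited-old (cl old v∉ e)
  ... | inj₂ refl = contradiction (here refl) v∉

  closed-revisit : ∀ {ℓ at x xs} → Visited ℓ at x → Closed ℓ at xs → Closed (suc ℓ) (extend at ℓ x) xs
  closed-revisit vx cl vv v∉ e = visited-old (cl (visited-revisit vx vv) v∉ e)

  closed-walk : ∀ {ℓ at k u v} → Closed ℓ at [] → Visited ℓ at u → Walk G k u v → Visited ℓ at v
  closed-walk cl vu nil        = vu
  closed-walk cl vu (cons e p) = closed-walk cl (cl vu (λ ()) e) p

  _≢?_ : (v x : Fin n) → Dec (v ≢ x)
  v ≢? x = ¬? (v Fin.≟ x)

  remove : Fin n → List (Fin n) → List (Fin n)
  remove x = filter (_≢? x)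

  length-remove : ∀ {x xs} → x ∈ xs → length (remove x xs) < length xs
  length-remove x∈ = filter-notAll _ _ (Any.map (λ x≡v v≢x → v≢x (sym x≡v)) x∈)

  Unvisited : ℕ → (ℕ → Fin n) → List (Fin n) → Set
  Unvisited ℓ at unseen = ∀ {v} → v ∈ unseen → ¬ Visited ℓ at v

  Covered : ℕ → (ℕ → Fin n) → List (Fin n) → Set
  Covered ℓ at unseen = ∀ {v} → v ∉ unseen → Visited ℓ at v

  unvisited-remove : ∀ {ℓ at x U} → Unvisited ℓ at U → Unvisited (suc ℓ) (extend at ℓ x) (remove x U)
  unvisited-remove {x = x} un v∈ vv with ∈-filter⁻ (_≢? x) v∈ | visited-extend⁻ vv
  ... | v∈U , _   | inj₁ old = un v∈U old
  ... | _   , v≢x | inj₂ v≡x = v≢x v≡x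

  covered-remove : ∀ {ℓ at x U} → Covered ℓ at U → Covered (suc ℓ) (extend at ℓ x) (remove x U)
  covered-remove {x = x} cov {v} v∉ with v Fin.≟ x
  ... | yes refl = visited-new
  ... | no  v≢x  = visited-old (cov λ v∈U → v∉ (∈-filter⁺ (_≢? x) v∈U v≢x))

  unvisited-revisit : ∀ {ℓ at x U} → Visited ℓ at x → Unvisited ℓ at U → Unvisited (suc ℓ) (extend at ℓ x) U
  unvisited-revisit vx un v∈ = un v∈ ∘ visited-revisit vx

  steps-extend : ∀ {at ℓ x} → (∀ t → t < ℓ → Step at t) → Step (extend at ℓ x) ℓ →
                 ∀ t → t < suc ℓ → Step (extend at ℓ x) t
  steps-extend steps last t t<1+ℓ with m≤n⇒m<n∨m≡n (s≤s⁻¹ t<1+ℓ)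
  ... | inj₁ t<ℓ  = step-extend t<ℓ (steps t t<ℓ)
  ... | inj₂ refl = last

  edge-step : ∀ {at ℓ y} → Edge (at ℓ) y → Step (extend at ℓ y) ℓ
  edge-step e = edge (subst₂ Edge (sym (extend-≤ ≤-refl)) (sym (extend-> ≤-refl)) e)

  stay-step : ∀ {at ℓ y} → at ℓ ≡ y → Step (extend at ℓ y) ℓ
  stay-step same = stay (trans (extend-≤ ≤-refl) (trans same (sym (extend-> ≤-refl))))

  jump-step : ∀ {at ℓ y} → (∀ s → s ≤ ℓ → ¬ Reachable (at s) y) → Step (extend at ℓ y) ℓ
  jump-step fresh = jump λ s s≤ℓ r →
    fresh s s≤ℓ (subst₂ Reachable (extend-≤ s≤ℓ) (extend-> ≤-refl) r)

  settled-extend : ∀ {at ℓ x} t → suc ℓ ≤ t → extend at ℓ x t ≡ extend at ℓ x (suc ℓ)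
  settled-extend t ℓ<t = trans (extend-> ℓ<t) (sym (extend-> ≤-refl))

  OnTop : (ℕ → Fin n) → ℕ → List (Fin n) → Set
  OnTop at ℓ []      = ⊤
  OnTop at ℓ (x ∷ _) = at ℓ ≡ x

  -- Each unseen vertex still costs two steps (reaching it, leaving it), each stacked one.
  potential : List (Fin n) → List (Fin n) → ℕ
  potential stack unseen = 2 * length unseen + length stack

  record State (stack unseen : List (Fin n)) : Set where
    field
      len       : ℕ
      at        : ℕ → Fin n
      on-top    : OnTop at len stack
      linked    : Linked Edge stack
      stacked   : All (Visited len at) stack
      closed    : Closed len at stack
      unvisited : Unvisited len at unseen
      covered   : Covered len at unseen
      steps     : ∀ t → t < len → Step at t
      settled   : ∀ t → len ≤ t → at t ≡ at len
      budget    : len + potential stack unseen < 2 * n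

  budget-advance : ∀ {ℓ p p′ b} → p′ < p → ℓ + p < b → suc ℓ + p′ < b
  budget-advance {ℓ} {p} {p′} {b} p′<p ℓ+p<b =
    subst (_< b) (+-suc ℓ p′) (≤-<-trans (+-monoʳ-≤ ℓ p′<p) ℓ+p<b)

  saturated : ∀ {ℓ at x U} → Covered ℓ at U → ¬ Any (Edge x) U → ∀ {y} → Edge x y → Visited ℓ at y
  saturated {x = x} cov none e = cov λ y∈U → none (Any.map (λ y≡v → subst (Edge x) y≡v e) y∈U)

  start : ∀ r → State (r ∷ []) (remove r (allFin n))
  start r = record
    { len       = 0
    ; at        = λ _ → r
    ; on-top    = refl
    ; linked    = [-]
    ; stacked   = (0 , z≤n , refl) ∷ []
    ; closed    = λ (_ , _ , r≡v) v∉ _ → contradiction (here (sym r≡v)) v∉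
    ; unvisited = λ v∈ (_ , _ , r≡v) → proj₂ (∈-filter⁻ (_≢? r) {xs = allFin n} v∈) (sym r≡v)
    ; covered   = covered
    ; steps     = λ _ ()
    ; settled   = λ _ _ → refl
    ; budget    = subst (2 * length U + 1 <_) (+-identityʳ (2 * n)) (m<n⇒2*m+[1+s]<2*n+s 0 fewer)
    }
    where
    U = remove r (allFin n)
    fewer : length U < n
    fewer = subst (length U <_) (length-tabulate id) (length-remove (∈-allFin r))
    covered : Covered 0 (λ _ → r) U
    covered {v} v∉ with v Fin.≟ r
    ... | yes refl = 0 , z≤n , refl
    ... | no  v≢r  = contradiction (∈-filter⁺ (_≢? r) (∈-allFin v) v≢r) v∉

  descend : ∀ {x xs U v} → State (x ∷ xs) U → v ∈ U → Edge x v → State (v ∷ x ∷ xs) (remove v U)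
  descend {v = v} s v∈U e = record
    { len       = suc len
    ; at        = extend at len v
    ; on-top    = extend-> ≤-refl
    ; linked    = edge-sym e ∷ linked
    ; stacked   = visited-new ∷ All.map visited-old stacked
    ; closed    = closed-extend (closed-cons closed)
    ; unvisited = unvisited-remove unvisited
    ; covered   = covered-remove covered
    ; steps     = steps-extend steps (edge-step (subst (λ x → Edge x v) (sym on-top) e))
    ; settled   = settled-extend
    ; budget    = budget-advance {len} (m<n⇒2*m+[1+s]<2*n+s _ (length-remove v∈U)) budget
    }
    where open State s

  backtrack : ∀ {x y xs U} → State (x ∷ y ∷ xs) U → ¬ Any (Edge x) U → State (y ∷ xs) U
  backtrack {y = y} {U = U} s none = record
    { len       = suc len
    ; at        = extend at len y
    ; on-top    = extend-> ≤-refl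
    ; linked    = Linked.tail linked
    ; stacked   = All.map visited-old (All.tail stacked)
    ; closed    = closed-revisit (All.head (All.tail stacked)) (closed-pop closed (saturated covered none))
    ; unvisited = unvisited-revisit (All.head (All.tail stacked)) unvisited
    ; covered   = visited-old ∘ covered
    ; steps     = steps-extend steps (edge-step (subst (λ x → Edge x y) (sym on-top) (Linked.head linked)))
    ; settled   = settled-extend
    ; budget    = budget-advance {len} (+-monoʳ-< (2 * length U) (n<1+n _)) budget
    }
    where open State s

  finish-component : ∀ {x U} → State (x ∷ []) U → ¬ Any (Edge x) U → State [] U
  finish-component {x} {U} s none = record
    { len       = suc len
    ; at        = extend at len x
    ; on-top    = tt
    ; linked    = []
    ; stacked   = []
    ; closed    = closed-revisit (All.head stacked) (closed-pop closed (saturated covered none))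
    ; unvisited = unvisited-revisit (All.head stacked) unvisited
    ; covered   = visited-old ∘ covered
    ; steps     = steps-extend steps (stay-step on-top)
    ; settled   = settled-extend
    ; budget    = budget-advance {len} (+-monoʳ-< (2 * length U) (n<1+n _)) budget
    }
    where open State s

  restart : ∀ {v U} → State [] (v ∷ U) → State (v ∷ []) (remove v (v ∷ U))
  restart {v} {U} s = record
    { len       = suc len
    ; at        = extend at len v
    ; on-top    = extend-> ≤-refl
    ; linked    = [-]
    ; stacked   = visited-new ∷ []
    ; closed    = closed-extend (closed-cons closed)
    ; unvisited = unvisited-remove unvisited
    ; covered   = covered-remove covered
    ; steps     = steps-extend steps (jump-step λ t t≤len (_ , p) →
                    unvisited (here refl) (closed-walk closed (t , t≤len , refl) p))
    ; settled   = settled-extend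
    ; budget    = budget-advance {len} (m<n⇒2*m+[1+s]<2*n+s 0 (length-remove {v} {v ∷ U} (here refl))) budget
    }
    where open State s

  spend : ∀ {b ℓ f} → b ≤ ℓ + suc f → b ≤ suc ℓ + f
  spend {b} {ℓ} {f} = subst (b ≤_) (+-suc ℓ f)

  -- Each move advances the trail by one step, so the budget bounds the number of moves.
  run : ∀ fuel {stack U} (s : State stack U) → 2 * n ≤ State.len s + fuel → State [] []
  run zero s 2n≤len =
    contradiction (subst (2 * n ≤_) (+-identityʳ len) 2n≤len) (<⇒≱ (≤-<-trans (m≤m+n len _) budget))
    where open State s
  run (suc fuel) {[]}    {[]}    s _  = s
  run (suc fuel) {[]}    {v ∷ U} s le = run fuel (restart s) (spend le)
  run (suc fuel) {x ∷ xs} {U}    s le with any? (λ v → adj G x v Bool.≟ true) U | xs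
  ... | yes nbr  | _ = let _ , v∈U , e = find nbr in run fuel (descend s v∈U e) (spend le)
  ... | no  none | [] = run fuel (finish-component s none) (spend le)
  ... | no  none | y ∷ ys = run fuel (backtrack s none) (spend le)

  traversal : Fin n → Traversal (2 * n)
  traversal r = record { at = at ; covers = covers ; step = step }
    where
    open State (run (2 * n) (start r) (m≤n+m (2 * n) 0))
    covers : ∀ v → ∃[ t ] t < 2 * n × at t ≡ v
    covers v = let t , t≤len , eq = covered {v} (λ ()) in
      t , ≤-<-trans t≤len (≤-<-trans (m≤m+n len _) budget) , eq
    step : ∀ t → Step at t
    step t with t <? len
    ... | yes t<len = steps t t<len
    ... | no  t≮len = let len≤t = ≮⇒≥ t≮len in
      stay (trans (settled t len≤t) (sym (settled (suc t) (m≤n⇒m≤1+n len≤t))))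

Move : Set
Move = Fin 4

pattern hold   = zero
pattern up     = suc zero
pattern down   = suc (suc zero)
pattern toggle = suc (suc (suc zero))

-- A profile is recorded by its increments; toggle switches between ∞ and finite, entering
-- the finite range at the stored entry value a.
apply : Move → ℕ → Maybe ℕ → Maybe ℕ
apply hold   a d        = d
apply up     a d        = Maybe.map suc d
apply down   a d        = Maybe.map pred d
apply toggle a (just _) = nothing
apply toggle a nothing  = just a

replay : ℕ → (ℕ → Move) → ℕ → Maybe ℕ
replay a σ zero    = apply (σ zero) a nothing
replay a σ (suc t) = apply (σ (suc t)) a (replay a σ t)

previous : (ℕ → Maybe ℕ) → ℕ → Maybe ℕ
previous p zero    = nothing
previous p (suc t) = p t

move : Maybe ℕ → Maybe ℕ → Move
move nothing  nothing  = hold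
move (just a) (just b) with <-cmp a b
... | tri< _ _ _ = up
... | tri≈ _ _ _ = hold
... | tri> _ _ _ = down
move _        _        = toggle

data Transition (a : ℕ) : Maybe ℕ → Maybe ℕ → Set where
  stay-∞ : Transition a nothing nothing
  enter  : Transition a nothing (just a)
  leave  : ∀ {b} → Transition a (just b) nothing
  close  : ∀ {b c} → Close (just b) (just c) → Transition a (just b) (just c)

apply-move : ∀ {a p c} → Transition a p c → apply (move p c) a p ≡ c
apply-move stay-∞ = refl
apply-move enter  = refl
apply-move leave  = refl
apply-move (close {b} {c} (fin∼fin b≤1+c c≤1+b)) with <-cmp b c
... | tri< b<c _ _ = cong just (≤-antisym b<c c≤1+b)
... | tri≈ _ refl _ = refl
... | tri> _ _ c<b = cong (just ∘ pred) (≤-antisym b≤1+c c<b)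

replay-moves : ∀ {a L} (p : ℕ → Maybe ℕ) (σ : ℕ → Move) →
               (∀ t → t < L → Transition a (previous p t) (p t)) →
               (∀ t → t < L → σ t ≡ move (previous p t) (p t)) →
               ∀ t → t < L → replay a σ t ≡ p t
replay-moves {a} p σ valid σ≡ zero    t<L rewrite σ≡ 0 t<L = apply-move (valid 0 t<L)
replay-moves {a} p σ valid σ≡ (suc t) t<L
  rewrite σ≡ (suc t) t<L | replay-moves p σ valid σ≡ t (<-trans (n<1+n t) t<L) =
  apply-move (valid (suc t) t<L)

module Universal (n L : ℕ) where

  Label : Set
  Label = Fin n × ℕ × (ℕ → Move)

  profile : Label → ℕ → Maybe ℕ
  profile (_ , a , σ) = replay a σ

  Adjacent : Label → Label → Set
  Adjacent x y = proj₁ x ≢ proj₁ y × (∀ {t} → t < L → Close (profile x t) (profile y t))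

  adjacent? : ∀ x y → Dec (Adjacent x y)
  adjacent? x y = ¬? (proj₁ x Fin.≟ proj₁ y) ×-dec allUpTo? (λ t → close? (profile x t) (profile y t)) L

  adjacent-sym : ∀ {x y} → Adjacent x y ⇔ Adjacent y x
  adjacent-sym = mk⇔ flip flip
    where
    flip : ∀ {x y} → Adjacent x y → Adjacent y x
    flip (x≢y , near) = x≢y ∘ sym , close-sym ∘ near

  M : ℕ
  M = n * (n * 4 ^ L)

  moves : Fin (4 ^ L) → ℕ → Move
  moves c t with t <? L
  ... | yes t<L = finToFun c (fromℕ< t<L)
  ... | no  _   = hold

  unpack : Fin n × Fin (4 ^ L) → ℕ × (ℕ → Move)
  unpack (a , c) = toℕ a , moves c

  decode : Fin M → Label
  decode x = let i , r = remQuot (n * 4 ^ L) x in i , unpack (remQuot (4 ^ L) r)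

  code : (ℕ → Move) → Fin (4 ^ L)
  code σ = funToFin {L} (σ ∘ toℕ)

  encode : Fin n → Fin n → (ℕ → Move) → Fin M
  encode i a σ = combine i (combine a (code σ))

  decode-encode : ∀ i a σ → decode (encode i a σ) ≡ (i , toℕ a , moves (code σ))
  decode-encode i a σ = begin
    decode (encode i a σ)                             ≡⟨ cong (λ (i , r) → i , unpack (remQuot (4 ^ L) r))
                                                            (Fin.remQuot-combine i (combine a (code σ))) ⟩
    i , unpack (remQuot (4 ^ L) (combine a (code σ))) ≡⟨ cong (λ r → i , unpack r)
                                                            (Fin.remQuot-combine a (code σ)) ⟩
    i , toℕ a , moves (code σ)                        ∎
    where open ≡-Reasoning

  moves-code : ∀ σ {t} → t < L → moves (code σ) t ≡ σ t
  moves-code σ {t} t<L with t <? L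
  ... | yes t<L′ = trans (Fin.finToFun-funToFin (σ ∘ toℕ {L}) (fromℕ< t<L′))
                         (cong σ (Fin.toℕ-fromℕ< t<L′))
  ... | no  t≮L  = contradiction t<L t≮L

  graph : Graph M
  graph = record
    { adj    = λ x y → does (adjacent? (decode x) (decode y))
    ; sym    = λ x y → does-⇔ adjacent-sym (adjacent? (decode x) (decode y)) (adjacent? (decode y) (decode x))
    ; irrefl = λ x → dec-false (adjacent? (decode x) (decode x)) (λ (x≢x , _) → x≢x refl)
    }

  edge⇒adjacent : ∀ {x y} → adj graph x y ≡ true → Adjacent (decode x) (decode y)
  edge⇒adjacent {x} {y} e = invert (subst (Reflects _) e (proof (adjacent? (decode x) (decode y))))

  profile-walk : ∀ {k x y t b} → t < L → Walk graph k x y → profile (decode y) t ≡ just b →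
                 ∃[ a ] profile (decode x) t ≡ just a × a ≤ k + b
  profile-walk t<L nil py = _ , py , ≤-refl
  profile-walk {x = x} {t = t} t<L (cons e p) py with profile-walk t<L p py
  ... | a′ , pz , a′≤k+b with close-just (subst (Close _) pz (proj₂ (edge⇒adjacent e) t<L))
  ...   | a , px , a≤1+a′ = a , px , ≤-trans a≤1+a′ (s≤s a′≤k+b)

firstJust : ∀ {A : Set} → ℕ → (ℕ → Maybe A) → Maybe A
firstJust zero    f = nothing
firstJust (suc b) f = f zero <∣> firstJust b (f ∘ suc)

firstJust-≡ : ∀ {A : Set} {b t x} (f : ℕ → Maybe A) → t < b → f t ≡ just x →
              (∀ s → s < t → f s ≡ nothing) → firstJust b f ≡ just x
firstJust-≡ {b = suc b} {zero}  f _   ft _    rewrite ft = refl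
firstJust-≡ {b = suc b} {suc t} f t<b ft none rewrite none 0 z<s =
  firstJust-≡ (f ∘ suc) (s≤s⁻¹ t<b) ft (λ s s<t → none (suc s) (s≤s s<t))

toℕ-mod : ∀ {m n} .{{_ : NonZero n}} → m < n → toℕ (m mod n) ≡ m
toℕ-mod {m} {n} m<n = trans (Fin.toℕ-fromℕ< _) (m<n⇒m%n≡m m<n)

module Embedding {n : ℕ} .{{_ : NonZero n}} (G : Graph n) {L : ℕ} (T : Traversals.Traversal G L) where
  open Walks G
  open Traversals G
  open Traversal T
  open Universal n L

  distances : Fin n → ℕ → Maybe ℕ
  distances u t = dist u (at t)

  -- Entries are distances, hence < n; the default 0 and mod only serve to land in Fin n.
  entry : Fin n → Fin n
  entry u = fromMaybe 0 (firstJust L (distances u)) mod n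

  profile-moves : Fin n → ℕ → Move
  profile-moves u t = move (previous (distances u) t) (distances u t)

  embed : Fin n → Fin M
  embed u = encode u (entry u) (profile-moves u)

  reachable-through : ∀ {u x y a b} → dist u x ≡ just a → dist u y ≡ just b → Reachable x y
  reachable-through ea eb = _ , reverse (dist≡just⇒walk ea) ++ dist≡just⇒walk eb

  consecutive-close : ∀ {u t a b} → previous (distances u) t ≡ just a → distances u t ≡ just b →
                      Close (just a) (just b)
  consecutive-close {u} {suc t} ea eb with step t
  ... | edge e     = subst₂ Close ea eb (close-target e)
  ... | stay same  with refl ← trans (sym ea) (trans (cong (dist u) same) eb) = fin∼fin (n≤1+n _) (n≤1+n _)
  ... | jump fresh = contradiction (reachable-through ea eb) (fresh t ≤-refl)

  ∞-before-entry : ∀ {u t b} → previous (distances u) t ≡ nothing → distances u t ≡ just b →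
                   ∀ s → s < t → distances u s ≡ nothing
  ∞-before-entry {u} {suc t} ∞ fin s s<1+t with distances u s in es | step t
  ... | nothing | _          = refl
  ... | just _  | edge e     with () ← subst₂ Close ∞ fin (close-target e)
  ... | just _  | stay same  with () ← trans (sym ∞) (trans (cong (dist u) same) fin)
  ... | just _  | jump fresh = contradiction (reachable-through es fin) (fresh s (s≤s⁻¹ s<1+t))

  entry-correct : ∀ {u t b} → t < L → previous (distances u) t ≡ nothing → distances u t ≡ just b →
                  toℕ (entry u) ≡ b
  entry-correct {u} {t} {b} t<L ∞ fin = begin
    toℕ (entry u) ≡⟨ cong (λ m → toℕ (fromMaybe 0 m mod n)) first ⟩
    toℕ (b mod n) ≡⟨ toℕ-mod (dist<n fin) ⟩
    b             ∎
    where
    open ≡-Reasoning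
    first : firstJust L (distances u) ≡ just b
    first = firstJust-≡ (distances u) t<L fin (∞-before-entry ∞ fin)

  transition : ∀ {u t} → t < L → Transition (toℕ (entry u)) (previous (distances u) t) (distances u t)
  transition {u} {t} t<L with previous (distances u) t in ep | distances u t in ec
  ... | nothing | nothing = stay-∞
  ... | nothing | just b  = subst (λ a → Transition a nothing (just b)) (sym (entry-correct t<L ep ec)) enter
  ... | just _  | nothing = leave
  ... | just _  | just _  = close (consecutive-close ep ec)

  profile-embed : ∀ u {t} → t < L → profile (decode (embed u)) t ≡ distances u t
  profile-embed u {t} t<L = begin
    profile (decode (embed u)) t              ≡⟨ cong (λ l → profile l t) (decode-encode u (entry u) σ) ⟩
    replay (toℕ (entry u)) (moves (code σ)) t ≡⟨ replay-moves (distances u) (moves (code σ))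
                                                   (λ _ → transition) (λ _ → moves-code σ) t t<L ⟩
    distances u t                             ∎
    where
    open ≡-Reasoning
    σ = profile-moves u

  name-embed : ∀ u → proj₁ (decode (embed u)) ≡ u
  name-embed u = cong proj₁ (decode-encode u (entry u) (profile-moves u))

  embed-injective : ∀ {u v} → embed u ≡ embed v → u ≡ v
  embed-injective {u} {v} eq = trans (sym (name-embed u)) (trans (cong (proj₁ ∘ decode) eq) (name-embed v))

  embed-edge : ∀ {u v} → Edge u v → adj graph (embed u) (embed v) ≡ true
  embed-edge {u} {v} e = dec-true (adjacent? (decode (embed u)) (decode (embed v))) (names-differ , near)
    where
    names-differ : proj₁ (decode (embed u)) ≢ proj₁ (decode (embed v))
    names-differ eq = edge-irrefl e (trans (sym (name-embed u)) (trans eq (name-embed v)))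
    near : ∀ {t} → t < L → Close (profile (decode (embed u)) t) (profile (decode (embed v)) t)
    near t<L = subst₂ Close (sym (profile-embed u t<L)) (sym (profile-embed v t<L)) (close-source e)

  walk-embed : ∀ {k u v} → Walk G k u v → Walk graph k (embed u) (embed v)
  walk-embed nil        = nil
  walk-embed (cons e p) = cons (embed-edge e) (walk-embed p)

  -- Read the profiles at a time t when the traversal visits v: there v is at distance 0.
  walk-unembed : ∀ {k u v} → Walk graph k (embed u) (embed v) → ∃[ j ] j ≤ k × Walk G j u v
  walk-unembed {k} {u} {v} q with covers v
  ... | t , t<L , refl with profile-walk t<L q (trans (profile-embed v t<L) (dist-refl v))
  ...   | j , pu , j≤k+0 =
    j , subst (j ≤_) (+-identityʳ k) j≤k+0 , dist≡just⇒walk (trans (sym (profile-embed u t<L)) pu)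

  isometric : IsometricCopy G graph
  isometric = embed , embed-injective , (λ _ _ → embed-edge) ,
              λ _ _ → dist-transfer walk-embed walk-unembed

theorem2p5 : Σ ℕ λ C → (n : ℕ) → 1 ≤ n →
    Σ ℕ λ m → m ≤ 16 ^ (n + C * ⌈log₂ n ⌉) × Σ (Graph m) λ H → IsometricUniversal n H
theorem2p5 = 2 , λ where
  (suc k) _ → let open Universal (suc k) (2 * suc k) in
    M , n²*16^n≤16^[n+2⌈log₂n⌉] (suc k) , graph ,
    λ G → Embedding.isometric G (DepthFirst.traversal G zero)
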